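{- Let $S$ be a diagram with $|S|=n$. If a type $\theta$ is chosen uniformly at random among all types of shape $S$, then the expected value of $|\mathrm{Tab}(\theta)|$ is $\dfrac{n!}{\prod_{\mathfrak c\in S}h_S(\mathfrak c)}$.
   Context: A diagram is a finite subset $S\subset\mathbb N_{>0}^2$; $(a,b)$ is the box in row $a$, column $b$. Arm $A_S(a,b)=\{(a,k)\in S:k>b\}$, leg $L_S(a,b)=\{(k,b)\in S:k\ge a\}$, hook $H_S=A_S\cup L_S$, $h_S=|H_S|$. A tableau of shape $S$ is a bijection $t:S\to\{1,\dots,n\}$. A type of shape $S$ is a map $\theta:S\to\mathbb Z$ with $0\le\theta(\mathfrak c)\le h_S(\mathfrak c)-1$. The type of a tableau $T$ is $\mathfrak c\mapsto|\{\mathfrak d\in H_S(\mathfrak c):t_{\mathfrak d}<t_{\mathfrak c}\}|$; $\mathrm{Tab}(\theta)$ is the set of tableaux of shape $S$ of type $\theta$. -}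

module Defs where

open import Data.Nat using (ℕ; zero; suc; _+_; _*_; _<_; _≤_; _<?_; _≤?_)
open import Data.Nat.Properties using (_≟_)
open import Data.Fin using (Fin; toℕ) renaming (zero to fzero; suc to fsuc)
import Data.Fin.Properties as FinP
open import Data.Product using (_×_; _,_; proj₁; proj₂; ∃)
open import Data.Sum using (_⊎_)
open import Data.List using (List; []; _∷_; length; lookup; concatMap; map; filter)
open import Data.List as L using ()
open import Data.Integer using (+_)
open import Data.Rational using (ℚ; 0ℚ; _/_)
open import Relation.Binary.PropositionalEquality using (_≡_)
open import Relation.Nullary using (Dec; yes; no; does)
open import Relation.Nullary.Decidable using (_×-dec_; _⊎-dec_; _→-dec_)
open import Data.List.Relation.Unary.Unique.Propositional using (Unique)
open import Data.List.Relation.Unary.All using (All)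
open import Data.Nat.ListAction using (sum; product)
import Agda.Primitive
open import Relation.Unary using (Pred; Decidable)

-- A diagram is a finite set of boxes (a, b) (row a, column b), with a, b > 0,
-- given as a duplicate-free list; its boxes are indexed by Fin (length S).
Box : Set
Box = ℕ × ℕ

IsDiagram : List Box → Set
IsDiagram S = Unique S × All (λ c → (0 < proj₁ c) × (0 < proj₂ c)) S

Cell : List Box → Set
Cell S = Fin (length S)

row col : (S : List Box) → Cell S → ℕ
row S c = proj₁ (lookup S c)
col S c = proj₂ (lookup S c)

InHook : (S : List Box) → Cell S → Cell S → Set
InHook S c d = ((row S d ≡ row S c) × (col S c < col S d))
             ⊎ ((col S d ≡ col S c) × (row S c ≤ row S d))

inHook? : (S : List Box) (c d : Cell S) → Dec (InHook S c d)
inHook? S c d = ((row S d ≟ row S c) ×-dec (col S c <? col S d))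
              ⊎-dec ((col S d ≟ col S c) ×-dec (row S c ≤? row S d))

countFin : ∀ {n} {P : Pred (Fin n) Agda.Primitive.lzero} → Decidable P → ℕ
countFin {n} P? = length (filter P? (L.allFin n))

hook : (S : List Box) → Cell S → ℕ
hook S c = countFin (inHook? S c)

prodHooks : List Box → ℕ
prodHooks S = product (map (hook S) (L.allFin (length S)))

-- Tableaux: bijections t : S → {1,…,n}; we use {0,…,n-1} ≅ Fin n
-- (a shift by one that preserves the order, so types are unchanged).
IsBijection : ∀ {n} → (Fin n → Fin n) → Set
IsBijection {n} t = (∀ i j → t i ≡ t j → i ≡ j) × (∀ j → ∃ λ i → t i ≡ j)

isBijection? : ∀ {n} (t : Fin n → Fin n) → Dec (IsBijection t)
isBijection? t =
  FinP.all? (λ i → FinP.all? (λ j → (t i FinP.≟ t j) →-dec (i FinP.≟ j)))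
  ×-dec FinP.all? (λ j → FinP.any? (λ i → t i FinP.≟ j))

typeOf : (S : List Box) → (Cell S → Fin (length S)) → Cell S → ℕ
typeOf S t c = countFin (λ d → inHook? S c d ×-dec (toℕ (t d) <? toℕ (t c)))

allDepFuns : (n : ℕ) (h : Fin n → ℕ) → List ((i : Fin n) → Fin (h i))
allDepFuns zero h = (λ ()) ∷ []
allDepFuns (suc n) h =
  concatMap (λ x → map (λ g → cons x g) (allDepFuns n (λ i → h (fsuc i))))
            (L.allFin (h fzero))
  where

  cons : Fin (h fzero) → ((i : Fin n) → Fin (h (fsuc i))) → (i : Fin (suc n)) → Fin (h i)
  cons x g fzero = x
  cons x g (fsuc i) = g i

-- Types of shape S: θ with 0 ≤ θ(c) ≤ h_S(c) − 1, i.e. θ(c) ∈ Fin (h_S c).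
ShapeType : List Box → Set
ShapeType S = (c : Cell S) → Fin (hook S c)

allTypes : (S : List Box) → List (ShapeType S)
allTypes S = allDepFuns (length S) (hook S)

allMaps : (S : List Box) → List (Cell S → Fin (length S))
allMaps S = allDepFuns (length S) (λ _ → length S)

numTab : (S : List Box) → ShapeType S → ℕ
numTab S θ = length (filter
  (λ t → isBijection? t ×-dec FinP.all? (λ c → typeOf S t c ≟ toℕ (θ c)))
  (allMaps S))

-- a / d as a rational number (0 if d = 0)
frac : ℕ → ℕ → ℚ
frac a zero = 0ℚ
frac a (suc d) = (+ a) / suc d

expectedTab : List Box → ℚ
expectedTab S = frac (sum (map (numTab S) (allTypes S))) (length (allTypes S))

-- Summing |Tab(θ)| over all types θ counts the pairs (T, θ) of a tableau T and
-- its type θ. Every bijection T has exactly one type: the value of its type at c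
-- counts boxes of H_S(c) other than c itself, and c ∈ H_S(c), so it lies below
-- h_S(c). Hence the sum is the number n! of bijections, while the number of
-- types is ∏ h_S(c).
module Submission where

open import Defs
open import Data.List using (List; length)
open import Data.Nat.Combinatorics using ()
open import Data.Nat using (_!)
open import Relation.Binary.PropositionalEquality using (_≡_)

open import Algebra.Properties.CommutativeSemigroup using (interchange)
open import Data.Empty using (⊥-elim)
open import Data.Fin using (Fin; toℕ; fromℕ<) renaming (zero to fzero; suc to fsuc)
open import Data.Fin.Properties
  using (all?; any?; 0≢1+n; suc-injective; toℕ-injective; toℕ-fromℕ<; injective⇒≤)
  renaming (_≟_ to _≟ᶠ_)
open import Data.List using ([]; _∷_; _++_; map; filter; concatMap; allFin)
open import Data.List.Membership.Propositional using (lose)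
open import Data.List.Membership.Propositional.Properties using (∈-filter⁺; ∈-allFin)
open import Data.List.Properties
  using (map-cong; map-∘; map-++; map-tabulate; length-++; length-map; length-tabulate;
         filter-notAll)
open import Data.Nat using (ℕ; zero; suc; _+_; _*_; _∸_; _<_; _<?_)
open import Data.Nat.Combinatorics.Base using (_P′_)
open import Data.Nat.Combinatorics.Specification using (nP′n≡n!)
open import Data.Nat.ListAction using (sum; product)
open import Data.Nat.ListAction.Properties using (sum-++)
open import Data.Nat.Properties
  using (_≟_; +-suc; +-identityʳ; *-comm; *-zeroʳ; *-identityʳ; *-distribʳ-+;
         +-commutativeSemigroup; m+n∸n≡m; ≤-refl; <-irrefl; module ≤-Reasoning)
open import Data.Product using (_×_; _,_; proj₁; proj₂; ∃; uncurry)
open import Data.Sum using (_⊎_; inj₁; inj₂)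
open import Function using (_∘_)
open import Level using (0ℓ)
open import Relation.Binary.PropositionalEquality
  using (refl; sym; trans; cong; cong₂; module ≡-Reasoning)
open import Relation.Nullary using (Dec; yes; no; ¬_)
open import Relation.Nullary.Decidable using (_×-dec_; _⊎-dec_; _→-dec_; ¬?)
open import Relation.Unary using (Pred; Decidable)

private variable
  A B C R : Set
  P Q : Pred A 0ℓ
  k m n : ℕ

indicator : Dec R → ℕ
indicator (yes _) = 1
indicator (no _)  = 0

count : {A : Set} {P : Pred A 0ℓ} → Decidable P → List A → ℕ
count P? xs = sum (map (λ x → indicator (P? x)) xs)

length-filter≡count : (P? : Decidable P) (xs : List A) → length (filter P? xs) ≡ count P? xs
length-filter≡count P? [] = refl
length-filter≡count P? (x ∷ xs) with P? x
... | yes _ = cong suc (length-filter≡count P? xs)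
... | no  _ = length-filter≡count P? xs

filter-×-dec : (P? : Decidable P) (Q? : Decidable Q) (xs : List A) →
               filter (λ x → P? x ×-dec Q? x) xs ≡ filter Q? (filter P? xs)
filter-×-dec P? Q? [] = refl
filter-×-dec P? Q? (x ∷ xs) with P? x
... | no  _ = filter-×-dec P? Q? xs
... | yes _ with Q? x
...   | yes _ = cong (x ∷_) (filter-×-dec P? Q? xs)
...   | no  _ = filter-×-dec P? Q? xs

sum-map-const : (c : ℕ) (xs : List A) → sum (map (λ _ → c) xs) ≡ length xs * c
sum-map-const c [] = refl
sum-map-const c (x ∷ xs) = cong (c +_) (sum-map-const c xs)

sum-map-+ : (f g : A → ℕ) (xs : List A) →
            sum (map (λ x → f x + g x) xs) ≡ sum (map f xs) + sum (map g xs)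
sum-map-+ f g [] = refl
sum-map-+ f g (x ∷ xs) =
  trans (cong (f x + g x +_) (sum-map-+ f g xs))
        (interchange +-commutativeSemigroup (f x) (g x) _ _)

sum-map-*ʳ : (f : A → ℕ) (c : ℕ) (xs : List A) →
             sum (map (λ x → f x * c) xs) ≡ sum (map f xs) * c
sum-map-*ʳ f c [] = refl
sum-map-*ʳ f c (x ∷ xs) =
  trans (cong (f x * c +_) (sum-map-*ʳ f c xs)) (sym (*-distribʳ-+ c (f x) _))

sum-map-swap : (f : A → B → ℕ) (xs : List A) (ys : List B) →
               sum (map (λ x → sum (map (f x) ys)) xs) ≡
               sum (map (λ y → sum (map (λ x → f x y) xs)) ys)
sum-map-swap f [] ys = sym (trans (sum-map-const 0 ys) (*-zeroʳ (length ys)))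
sum-map-swap f (x ∷ xs) ys =
  trans (cong (sum (map (f x) ys) +_) (sum-map-swap f xs ys))
        (sym (sum-map-+ (f x) (λ y → sum (map (λ x → f x y) xs)) ys))

length-concatMap-map : (f : A → B → C) (xs : List A) (ys : List B) →
                       length (concatMap (λ x → map (f x) ys) xs) ≡ length xs * length ys
length-concatMap-map f [] ys = refl
length-concatMap-map f (x ∷ xs) ys =
  trans (length-++ (map (f x) ys))
        (cong₂ _+_ (length-map (f x) ys) (length-concatMap-map f xs ys))

count-cong : (P? : Decidable P) (Q? : Decidable Q) →
             (∀ x → P x → Q x) → (∀ x → Q x → P x) →
             (xs : List A) → count P? xs ≡ count Q? xs
count-cong P? Q? P⇒Q Q⇒P xs = cong sum (map-cong indicator-cong xs)
  where
  indicator-cong : ∀ x → indicator (P? x) ≡ indicator (Q? x)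
  indicator-cong x with P? x | Q? x
  ... | yes _ | yes _ = refl
  ... | no  _ | no  _ = refl
  ... | yes p | no ¬q = ⊥-elim (¬q (P⇒Q x p))
  ... | no ¬p | yes q = ⊥-elim (¬p (Q⇒P x q))

count-none : (P? : Decidable P) → (∀ x → ¬ P x) → (xs : List A) → count P? xs ≡ 0
count-none P? ¬P [] = refl
count-none P? ¬P (x ∷ xs) with P? x
... | yes p = ⊥-elim (¬P x p)
... | no  _ = count-none P? ¬P xs

count-all : (P? : Decidable P) → (∀ x → P x) → (xs : List A) → count P? xs ≡ length xs
count-all P? all-P [] = refl
count-all P? all-P (x ∷ xs) with P? x
... | yes _ = cong suc (count-all P? all-P xs)
... | no ¬p = ⊥-elim (¬p (all-P x))

count-map : (P? : Decidable P) (f : B → A) (xs : List B) →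
            count P? (map f xs) ≡ count (P? ∘ f) xs
count-map P? f xs = cong sum (sym (map-∘ xs))

count-concatMap : (P? : Decidable P) (f : B → List A) (xs : List B) →
                  count P? (concatMap f xs) ≡ sum (map (count P? ∘ f) xs)
count-concatMap P? f [] = refl
count-concatMap P? f (x ∷ xs) = begin
  sum (map (indicator ∘ P?) (f x ++ concatMap f xs))
    ≡⟨ cong sum (map-++ (indicator ∘ P?) (f x) (concatMap f xs)) ⟩
  sum (map (indicator ∘ P?) (f x) ++ map (indicator ∘ P?) (concatMap f xs))
    ≡⟨ sum-++ (map (indicator ∘ P?) (f x)) _ ⟩
  count P? (f x) + count P? (concatMap f xs)
    ≡⟨ cong (count P? (f x) +_) (count-concatMap P? f xs) ⟩
  count P? (f x) + sum (map (count P? ∘ f) xs) ∎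
  where open ≡-Reasoning

count-⊎ : (P? : Decidable P) (Q? : Decidable Q) → (∀ x → P x → ¬ Q x) → (xs : List A) →
          count (λ x → P? x ⊎-dec Q? x) xs ≡ count P? xs + count Q? xs
count-⊎ P? Q? disjoint xs =
  trans (cong sum (map-cong indicator-⊎ xs)) (sum-map-+ (indicator ∘ P?) (indicator ∘ Q?) xs)
  where
  indicator-⊎ : ∀ x → indicator (P? x ⊎-dec Q? x) ≡ indicator (P? x) + indicator (Q? x)
  indicator-⊎ x with P? x | Q? x
  ... | yes p | yes q = ⊥-elim (disjoint x p q)
  ... | yes _ | no  _ = refl
  ... | no  _ | yes _ = refl
  ... | no  _ | no  _ = refl

count-¬+count : (P? : Decidable P) (xs : List A) → count (¬? ∘ P?) xs + count P? xs ≡ length xs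
count-¬+count P? [] = refl
count-¬+count P? (x ∷ xs) with P? x
... | yes _ = trans (+-suc _ _) (cong suc (count-¬+count P? xs))
... | no  _ = cong suc (count-¬+count P? xs)

count-×-const : (R? : Dec R) (P? : Decidable P) (xs : List A) {c : ℕ} →
                (R → count P? xs ≡ c) → count (λ x → R? ×-dec P? x) xs ≡ indicator R? * c
count-×-const (yes r) P? xs hyp =
  trans (count-cong _ P? (λ _ → proj₂) (λ _ → r ,_) xs) (trans (hyp r) (sym (+-identityʳ _)))
count-×-const (no ¬r) P? xs hyp = count-none (λ x → no ¬r ×-dec P? x) (λ _ → ¬r ∘ proj₁) xs

length-allFin : length (allFin n) ≡ n
length-allFin = length-tabulate (λ i → i)

allFin-suc : allFin (suc n) ≡ fzero ∷ map fsuc (allFin n)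
allFin-suc = cong (fzero ∷_) (sym (map-tabulate (λ i → i) fsuc))

count-≡-allFin : (a : Fin m) → count (_≟ᶠ a) (allFin m) ≡ 1
count-≡-allFin {suc m} fzero = begin
  count (_≟ᶠ fzero) (allFin (suc m))             ≡⟨ cong (count (_≟ᶠ fzero)) (allFin-suc {m}) ⟩
  suc (count (_≟ᶠ fzero) (map fsuc (allFin m)))  ≡⟨ cong suc (count-map (_≟ᶠ fzero) fsuc (allFin m)) ⟩
  suc (count (λ x → fsuc x ≟ᶠ fzero) (allFin m))
    ≡⟨ cong suc (count-none (λ x → fsuc x ≟ᶠ fzero) (λ _ ()) (allFin m)) ⟩
  1                                              ∎
  where open ≡-Reasoning
count-≡-allFin {suc m} (fsuc a) = begin
  count (_≟ᶠ fsuc a) (allFin (suc m))            ≡⟨ cong (count (_≟ᶠ fsuc a)) (allFin-suc {m}) ⟩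
  count (_≟ᶠ fsuc a) (map fsuc (allFin m))       ≡⟨ count-map (_≟ᶠ fsuc a) fsuc (allFin m) ⟩
  count (λ x → fsuc x ≟ᶠ fsuc a) (allFin m)
    ≡⟨ count-cong _ (_≟ᶠ a) (λ _ → suc-injective) (λ _ → cong fsuc) (allFin m) ⟩
  count (_≟ᶠ a) (allFin m)                       ≡⟨ count-≡-allFin a ⟩
  1                                              ∎
  where open ≡-Reasoning

DepFun : (n : ℕ) → (Fin n → ℕ) → Set
DepFun n h = (i : Fin n) → Fin (h i)

cons : {h : Fin (suc n) → ℕ} → Fin (h fzero) → DepFun n (h ∘ fsuc) → DepFun (suc n) h
cons x g fzero    = x
cons x g (fsuc i) = g i

_≗ᵈ_ : {h : Fin n → ℕ} → DepFun n h → DepFun n h → Set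
f ≗ᵈ g = ∀ i → f i ≡ g i

_≗ᵈ?_ : {h : Fin n → ℕ} (f g : DepFun n h) → Dec (f ≗ᵈ g)
f ≗ᵈ? g = all? (λ i → f i ≟ᶠ g i)

length-allDepFuns : (n : ℕ) (h : Fin n → ℕ) →
                    length (allDepFuns n h) ≡ product (map h (allFin n))
length-allDepFuns zero h = refl
length-allDepFuns (suc n) h = begin
  length (allDepFuns (suc n) h)
    ≡⟨ length-concatMap-map _ (allFin (h fzero)) rest ⟩
  length (allFin (h fzero)) * length rest
    ≡⟨ cong₂ _*_ (length-allFin {h fzero}) (length-allDepFuns n (h ∘ fsuc)) ⟩
  h fzero * product (map (h ∘ fsuc) (allFin n))
    ≡⟨ cong (λ hs → h fzero * product hs) (map-∘ (allFin n)) ⟩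
  h fzero * product (map h (map fsuc (allFin n)))
    ≡⟨ cong (product ∘ map h) (sym (allFin-suc {n})) ⟩
  product (map h (allFin (suc n))) ∎
  where
  open ≡-Reasoning
  rest : List (DepFun n (h ∘ fsuc))
  rest = allDepFuns n (h ∘ fsuc)

-- allDepFuns builds its elements with a cons of its own, which agrees with cons
-- only pointwise; without function extensionality P must respect _≗ᵈ_.
count-allDepFuns-suc : {h : Fin (suc n) → ℕ} {P : Pred (DepFun (suc n) h) 0ℓ} (P? : Decidable P) →
                       (∀ {f g} → f ≗ᵈ g → P f → P g) →
                       count P? (allDepFuns (suc n) h) ≡
                       sum (map (λ x → count (P? ∘ cons x) (allDepFuns n (h ∘ fsuc))) (allFin (h fzero)))
count-allDepFuns-suc {n} {h} P? resp =
  trans (count-concatMap P? _ (allFin (h fzero)))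
        (cong sum (map-cong (λ x → trans (count-map P? _ rest)
                                          (count-cong _ _ (λ _ → resp λ { fzero → refl ; (fsuc _) → refl })
                                                          (λ _ → resp λ { fzero → refl ; (fsuc _) → refl })
                                                          rest))
                            (allFin (h fzero))))
  where
  rest : List (DepFun n (h ∘ fsuc))
  rest = allDepFuns n (h ∘ fsuc)

count-≗ᵈ-allDepFuns : (n : ℕ) (h : Fin n → ℕ) (g : DepFun n h) →
                      count (_≗ᵈ? g) (allDepFuns n h) ≡ 1
count-≗ᵈ-allDepFuns zero h g = count-all (_≗ᵈ? g) (λ _ ()) (allDepFuns zero h)
count-≗ᵈ-allDepFuns (suc n) h g = begin
  count (_≗ᵈ? g) (allDepFuns (suc n) h)
    ≡⟨ count-allDepFuns-suc (_≗ᵈ? g) (λ f≗f′ f≗g i → trans (sym (f≗f′ i)) (f≗g i)) ⟩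
  sum (map (λ x → count (λ g′ → cons x g′ ≗ᵈ? g) rest) (allFin (h fzero)))
    ≡⟨ cong sum (map-cong count-cons (allFin (h fzero))) ⟩
  sum (map (λ x → indicator (x ≟ᶠ g fzero) * 1) (allFin (h fzero)))
    ≡⟨ cong sum (map-cong (λ x → *-identityʳ _) (allFin (h fzero))) ⟩
  count (_≟ᶠ g fzero) (allFin (h fzero))
    ≡⟨ count-≡-allFin (g fzero) ⟩
  1 ∎
  where
  open ≡-Reasoning
  rest : List (DepFun n (h ∘ fsuc))
  rest = allDepFuns n (h ∘ fsuc)
  split : ∀ {x} g′ → cons x g′ ≗ᵈ g → x ≡ g fzero × g′ ≗ᵈ (g ∘ fsuc)
  split g′ e = e fzero , e ∘ fsuc
  merge : ∀ {x} g′ → x ≡ g fzero × g′ ≗ᵈ (g ∘ fsuc) → cons x g′ ≗ᵈ g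
  merge g′ (e , e′) fzero    = e
  merge g′ (e , e′) (fsuc i) = e′ i
  count-cons : ∀ x → count (λ g′ → cons x g′ ≗ᵈ? g) rest ≡ indicator (x ≟ᶠ g fzero) * 1
  count-cons x =
    trans (count-cong _ (λ g′ → (x ≟ᶠ g fzero) ×-dec (g′ ≗ᵈ? (g ∘ fsuc))) split merge rest)
          (count-×-const (x ≟ᶠ g fzero) (_≗ᵈ? (g ∘ fsuc)) rest
                         (λ _ → count-≗ᵈ-allDepFuns n (h ∘ fsuc) (g ∘ fsuc)))

IsInjection : (Fin k → Fin m) → Set
IsInjection g = ∀ i j → g i ≡ g j → i ≡ j

isInjection? : (g : Fin k → Fin m) → Dec (IsInjection g)
isInjection? g = all? λ i → all? λ j → (g i ≟ᶠ g j) →-dec (i ≟ᶠ j)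

InImage : (Fin k → Fin m) → Fin m → Set
InImage g y = ∃ λ i → g i ≡ y

inImage? : (g : Fin k → Fin m) → Decidable (InImage g)
inImage? g y = any? λ i → g i ≟ᶠ y

injective-∘fsuc : {g : Fin (suc k) → Fin m} → IsInjection g → IsInjection (g ∘ fsuc)
injective-∘fsuc inj i j e = suc-injective (inj (fsuc i) (fsuc j) e)

injective-cons⁻ : {y : Fin m} {g : Fin k → Fin m} →
                  IsInjection (cons y g) → IsInjection g × ¬ InImage g y
injective-cons⁻ inj = injective-∘fsuc inj , λ { (i , e) → 0≢1+n (inj fzero (fsuc i) (sym e)) }

injective-cons⁺ : {y : Fin m} {g : Fin k → Fin m} →
                  IsInjection g → ¬ InImage g y → IsInjection (cons y g)
injective-cons⁺ inj y∉g fzero    fzero    e = refl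
injective-cons⁺ inj y∉g fzero    (fsuc j) e = ⊥-elim (y∉g (j , sym e))
injective-cons⁺ inj y∉g (fsuc i) fzero    e = ⊥-elim (y∉g (i , e))
injective-cons⁺ inj y∉g (fsuc i) (fsuc j) e = cong fsuc (inj i j e)

-- A value y missed by t extends t to an injection Fin (suc n) → Fin n.
injective⇒surjective : (t : Fin n → Fin n) → IsInjection t → ∀ y → InImage t y
injective⇒surjective t inj y with inImage? t y
... | yes y∈t = y∈t
... | no  y∉t = ⊥-elim (<-irrefl refl (injective⇒≤ λ {i} {j} → injective-cons⁺ inj y∉t i j))

count-inImage : (g : Fin k → Fin m) → IsInjection g → count (inImage? g) (allFin m) ≡ k
count-inImage {zero} g _ = count-none (inImage? g) (λ _ ()) (allFin _)
count-inImage {suc k} {m} g inj = begin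
  count (inImage? g) (allFin m)
    ≡⟨ count-cong _ (λ y → (y ≟ᶠ g fzero) ⊎-dec inImage? (g ∘ fsuc) y) split merge (allFin m) ⟩
  count (λ y → (y ≟ᶠ g fzero) ⊎-dec inImage? (g ∘ fsuc) y) (allFin m)
    ≡⟨ count-⊎ (_≟ᶠ g fzero) (inImage? (g ∘ fsuc)) disjoint (allFin m) ⟩
  count (_≟ᶠ g fzero) (allFin m) + count (inImage? (g ∘ fsuc)) (allFin m)
    ≡⟨ cong₂ _+_ (count-≡-allFin (g fzero)) (count-inImage (g ∘ fsuc) (injective-∘fsuc inj)) ⟩
  suc k ∎
  where
  open ≡-Reasoning
  split : ∀ y → InImage g y → y ≡ g fzero ⊎ InImage (g ∘ fsuc) y
  split y (fzero  , e) = inj₁ (sym e)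
  split y (fsuc i , e) = inj₂ (i , e)
  merge : ∀ y → y ≡ g fzero ⊎ InImage (g ∘ fsuc) y → InImage g y
  merge y (inj₁ e)       = fzero , sym e
  merge y (inj₂ (i , e)) = fsuc i , e
  disjoint : ∀ y → y ≡ g fzero → ¬ InImage (g ∘ fsuc) y
  disjoint y refl (i , e) = 0≢1+n (inj fzero (fsuc i) (sym e))

count-∉image : (g : Fin k → Fin m) → IsInjection g → count (¬? ∘ inImage? g) (allFin m) ≡ m ∸ k
count-∉image {k} {m} g inj = begin
  c                                     ≡⟨ m+n∸n≡m c k ⟨
  c + k ∸ k                             ≡⟨ cong (λ k′ → c + k′ ∸ k) (count-inImage g inj) ⟨
  c + count (inImage? g) (allFin m) ∸ k ≡⟨ cong (_∸ k) (count-¬+count (inImage? g) (allFin m)) ⟩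
  length (allFin m) ∸ k                 ≡⟨ cong (_∸ k) length-allFin ⟩
  m ∸ k                                 ∎
  where
  open ≡-Reasoning
  c : ℕ
  c = count (¬? ∘ inImage? g) (allFin m)

count-injections : (k m : ℕ) → count isInjection? (allDepFuns k (λ _ → m)) ≡ m P′ k
count-injections zero m = count-all isInjection? (λ _ ()) (allDepFuns zero (λ _ → m))
count-injections (suc k) m = begin
  count isInjection? (allDepFuns (suc k) (λ _ → m))
    ≡⟨ count-allDepFuns-suc isInjection? respects ⟩
  sum (map (λ y → count (isInjection? ∘ cons y) maps) (allFin m))
    ≡⟨ cong sum (map-cong (λ y → count-cong _ _ (λ _ → injective-cons⁻)
                                                (λ _ → uncurry injective-cons⁺) maps) (allFin m)) ⟩
  sum (map (λ y → count (λ g → isInjection? g ×-dec ¬? (inImage? g y)) maps) (allFin m))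
    ≡⟨ sum-map-swap (λ y g → indicator (isInjection? g ×-dec ¬? (inImage? g y))) (allFin m) maps ⟩
  sum (map (λ g → count (λ y → isInjection? g ×-dec ¬? (inImage? g y)) (allFin m)) maps)
    ≡⟨ cong sum (map-cong (λ g → count-×-const (isInjection? g) _ (allFin m) (count-∉image g)) maps) ⟩
  sum (map (λ g → indicator (isInjection? g) * (m ∸ k)) maps)
    ≡⟨ sum-map-*ʳ (indicator ∘ isInjection?) (m ∸ k) maps ⟩
  count isInjection? maps * (m ∸ k)
    ≡⟨ cong (_* (m ∸ k)) (count-injections k m) ⟩
  (m P′ k) * (m ∸ k)
    ≡⟨ *-comm (m P′ k) (m ∸ k) ⟩
  m P′ suc k ∎
  where
  open ≡-Reasoning
  maps : List (Fin k → Fin m)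
  maps = allDepFuns k (λ _ → m)
  respects : ∀ {f g : Fin (suc k) → Fin m} → f ≗ᵈ g → IsInjection f → IsInjection g
  respects f≗g inj i j e = inj i j (trans (f≗g i) (trans e (sym (f≗g j))))

count-bijections : (n : ℕ) → count isBijection? (allDepFuns n (λ _ → n)) ≡ n !
count-bijections n = begin
  count isBijection? maps
    ≡⟨ count-cong _ _ (λ _ → proj₁) (λ t inj → inj , injective⇒surjective t inj) maps ⟩
  count isInjection? maps ≡⟨ count-injections n n ⟩
  n P′ n                  ≡⟨ nP′n≡n! n ⟩
  n !                     ∎
  where
  open ≡-Reasoning
  maps : List (Fin n → Fin n)
  maps = allDepFuns n (λ _ → n)

typeOf<hook : (S : List Box) (t : Cell S → Fin (length S)) (c : Cell S) → typeOf S t c < hook S c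
typeOf<hook S t c = begin-strict
  typeOf S t c
    ≡⟨ cong length (filter-×-dec (inHook? S c) earlier? cells) ⟩
  length (filter earlier? (filter (inHook? S c) cells))
    <⟨ filter-notAll earlier? _ (lose (∈-filter⁺ (inHook? S c) (∈-allFin c) c∈Hc) (<-irrefl refl)) ⟩
  hook S c ∎
  where
  open ≤-Reasoning
  cells : List (Cell S)
  cells = allFin (length S)
  earlier? : Decidable (λ d → toℕ (t d) < toℕ (t c))
  earlier? d = toℕ (t d) <? toℕ (t c)
  c∈Hc : InHook S c c
  c∈Hc = inj₂ (refl , ≤-refl)

tableauType : (S : List Box) → (Cell S → Fin (length S)) → ShapeType S
tableauType S t c = fromℕ< (typeOf<hook S t c)

HasType : (S : List Box) → (Cell S → Fin (length S)) → ShapeType S → Set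
HasType S t θ = ∀ c → typeOf S t c ≡ toℕ (θ c)

hasType? : (S : List Box) (t : Cell S → Fin (length S)) → Decidable (HasType S t)
hasType? S t θ = all? λ c → typeOf S t c ≟ toℕ (θ c)

count-hasType : (S : List Box) (t : Cell S → Fin (length S)) →
                count (hasType? S t) (allTypes S) ≡ 1
count-hasType S t =
  trans (count-cong (hasType? S t) (_≗ᵈ? tableauType S t) to from (allTypes S))
        (count-≗ᵈ-allDepFuns (length S) (hook S) (tableauType S t))
  where
  to : ∀ θ → HasType S t θ → θ ≗ᵈ tableauType S t
  to θ e c = toℕ-injective (trans (sym (e c)) (sym (toℕ-fromℕ< (typeOf<hook S t c))))
  from : ∀ θ → θ ≗ᵈ tableauType S t → HasType S t θ
  from θ e c = trans (sym (toℕ-fromℕ< (typeOf<hook S t c))) (cong toℕ (sym (e c)))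

sum-numTab : (S : List Box) → sum (map (numTab S) (allTypes S)) ≡ length S !
sum-numTab S = begin
  sum (map (numTab S) types)
    ≡⟨ cong sum (map-cong (λ θ → length-filter≡count (pair? θ) maps) types) ⟩
  sum (map (λ θ → count (pair? θ) maps) types)
    ≡⟨ sum-map-swap (λ θ t → indicator (pair? θ t)) types maps ⟩
  sum (map (λ t → count (λ θ → pair? θ t) types) maps)
    ≡⟨ cong sum (map-cong (λ t → count-×-const (isBijection? t) (hasType? S t) types
                                               (λ _ → count-hasType S t)) maps) ⟩
  sum (map (λ t → indicator (isBijection? t) * 1) maps)
    ≡⟨ cong sum (map-cong (λ t → *-identityʳ _) maps) ⟩
  count isBijection? maps
    ≡⟨ count-bijections (length S) ⟩
  length S ! ∎
  where
  open ≡-Reasoning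
  types : List (ShapeType S)
  types = allTypes S
  maps : List (Cell S → Fin (length S))
  maps = allMaps S
  pair? : ∀ θ t → Dec (IsBijection t × HasType S t θ)
  pair? θ t = isBijection? t ×-dec hasType? S t θ

mainTheorem7 : (S : List Box) → IsDiagram S →
    expectedTab S ≡ frac (length S !) (prodHooks S)
mainTheorem7 S _ = cong₂ frac (sum-numTab S) (length-allDepFuns (length S) (hook S))
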